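{- Let $(S_n)_{n\ge0}$ be defined by $S_0=3$, $S_1=1$, $S_2=3$ and $S_{n+1}=S_n+S_{n-1}+S_{n-2}$ for $n\ge2$. Let $\alpha,\beta,\gamma$ be the roots of $x^3-x^2-x-1=0$ and $C_n=\alpha^n\beta^n+\alpha^n\gamma^n+\beta^n\gamma^n$ for $n\ge0$. Then for all integers $n\ge0$, $$2S_n=C_n^2-C_{2n}.$$
   Context: $S_n=\alpha^n+\beta^n+\gamma^n$. -}

module Defs where

open import Level using (Level)
open import Data.Nat using (ℕ; zero; suc)
open import Data.Product using (_×_)
open import Algebra.Bundles using (CommutativeRing)

S : ℕ → ℕ
S zero = 3
S (suc zero) = 1
S (suc (suc zero)) = 3
S (suc (suc (suc n))) = S (suc (suc n)) + S (suc n) + S n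
  where open Data.Nat using (_+_)

module _ {c ℓ : Level} (R : CommutativeRing c ℓ) where
  open CommutativeRing R

  pow : Carrier → ℕ → Carrier
  pow x zero = 1#
  pow x (suc n) = x * pow x n

  fromℕ : ℕ → Carrier
  fromℕ zero = 0#
  fromℕ (suc n) = 1# + fromℕ n

  -- α, β, γ are the roots (with multiplicity) of x³ − x² − x − 1, i.e.
  -- (x − α)(x − β)(x − γ) = x³ − (α+β+γ)x² + (αβ+αγ+βγ)x − αβγ
  -- coincides coefficientwise with x³ − x² − x − 1.
  AreRootsOfCubic : Carrier → Carrier → Carrier → Set ℓ
  AreRootsOfCubic α β γ =
      (- (α + β + γ) ≈ - 1#)
    × ((α * β + α * γ + β * γ) ≈ - 1#)
    × (- (α * β * γ) ≈ - 1#)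

  C : Carrier → Carrier → Carrier → ℕ → Carrier
  C α β γ n = pow α n * pow β n + pow α n * pow γ n + pow β n * pow γ n

-- Write a = αⁿ, b = βⁿ, c = γⁿ. Then Cₙ = e₂(a,b,c) and C₂ₙ = e₂(a²,b²,c²), and the
-- polynomial identity e₂(a,b,c)² − e₂(a²,b²,c²) = 2 e₃(a,b,c) e₁(a,b,c) reduces the claim to
-- e₃(a,b,c) = (αβγ)ⁿ = 1 and e₁(a,b,c) = Sₙ. The power sums pₙ = αⁿ + βⁿ + γⁿ obey Newton's
-- recurrence pₙ₊₃ = e₁pₙ₊₂ − e₂pₙ₊₁ + e₃pₙ, which for x³ − x² − x − 1 is the recurrence of S,
-- and p₀ = 3, p₁ = e₁ = 1, p₂ = e₁² − 2e₂ = 3 are the initial values of S.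

{-# OPTIONS --safe #-}
module Submission where

open import Defs
open import Data.Nat using (ℕ; zero; suc) renaming (_*_ to _*ℕ_; _+_ to _+ℕ_)
import Data.Nat.Properties as ℕ
open import Data.Product using (_,_)
open import Algebra.Bundles using (Semiring; CommutativeSemiring; CommutativeRing)
open import Relation.Binary.PropositionalEquality as ≡ using (_≡_)
import Algebra.Solver.Ring.NaturalCoefficients.Default as NaturalCoefficientsSolver
import Algebra.Properties.Semiring.Exp as Exp
import Algebra.Properties.CommutativeSemiring.Exp as CommutativeExp
import Algebra.Properties.Semiring.Mult as Mult
import Algebra.Properties.Ring as RingProperties
import Algebra.Properties.Group as GroupProperties
import Relation.Binary.Reasoning.Setoid as SetoidReasoning

module Exponentiation {c ℓ} (R : Semiring c ℓ) where
  open Semiring R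
  open Exp R using (_^_; ^-homo-*; ^-congʳ)

  ^-zeroˡ : ∀ n → 1# ^ n ≈ 1#
  ^-zeroˡ zero    = refl
  ^-zeroˡ (suc n) = trans (*-identityˡ (1# ^ n)) (^-zeroˡ n)

  ^-double : ∀ x n → x ^ (2 *ℕ n) ≈ x ^ n * x ^ n
  ^-double x n = trans (^-homo-* x n (n +ℕ 0)) (*-congˡ (^-congʳ x (ℕ.+-identityʳ n)))

module Tribonacci {c ℓ} (R : Semiring c ℓ) where
  open Semiring R
  open Mult R using (_×_; ×-homo-+)
  open SetoidReasoning setoid

  IsTribonacci : (ℕ → Carrier) → Set ℓ
  IsTribonacci u = ∀ n → u (3 +ℕ n) ≈ u (2 +ℕ n) + u (1 +ℕ n) + u n

  tribonacci-unique : ∀ {u v} → IsTribonacci u → IsTribonacci v →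
    u 0 ≈ v 0 → u 1 ≈ v 1 → u 2 ≈ v 2 → ∀ n → u n ≈ v n
  tribonacci-unique {u} {v} u-trib v-trib u₀≈v₀ u₁≈v₁ u₂≈v₂ = go
    where
    go : ∀ n → u n ≈ v n
    go 0 = u₀≈v₀
    go 1 = u₁≈v₁
    go 2 = u₂≈v₂
    go (suc (suc (suc n))) = begin
      u (3 +ℕ n)                     ≈⟨ u-trib n ⟩
      u (2 +ℕ n) + u (1 +ℕ n) + u n  ≈⟨ +-cong (+-cong (go (suc (suc n))) (go (suc n))) (go n) ⟩
      v (2 +ℕ n) + v (1 +ℕ n) + v n  ≈⟨ v-trib n ⟨
      v (3 +ℕ n)                     ∎

  S-isTribonacci : IsTribonacci (λ n → S n × 1#)
  S-isTribonacci n = begin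
    (S (2 +ℕ n) +ℕ S (1 +ℕ n) +ℕ S n) × 1#        ≈⟨ ×-homo-+ 1# (S (2 +ℕ n) +ℕ S (1 +ℕ n)) (S n) ⟩
    (S (2 +ℕ n) +ℕ S (1 +ℕ n)) × 1# + S n × 1#    ≈⟨ +-congʳ (×-homo-+ 1# (S (2 +ℕ n)) (S (1 +ℕ n))) ⟩
    S (2 +ℕ n) × 1# + S (1 +ℕ n) × 1# + S n × 1#  ∎

module SymmetricFunctions {c ℓ} (R : CommutativeSemiring c ℓ) where
  open CommutativeSemiring R
  open CommutativeExp R using (_^_; ^-distrib-*)
  open NaturalCoefficientsSolver R using (solve; _:=_; _:+_; _:*_; con)
  open SetoidReasoning setoid

  e₁ e₂ e₃ : Carrier → Carrier → Carrier → Carrier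
  e₁ x y z = x + y + z
  e₂ x y z = x * y + x * z + y * z
  e₃ x y z = x * y * z

  powerSum : Carrier → Carrier → Carrier → ℕ → Carrier
  powerSum x y z n = x ^ n + y ^ n + z ^ n

  -- Newton's identity p₍ₙ₊₃₎ = e₁ p₍ₙ₊₂₎ − e₂ p₍ₙ₊₁₎ + e₃ pₙ, with the negative term moved across.
  powerSum-newton : ∀ x y z n →
    powerSum x y z (3 +ℕ n) + e₂ x y z * powerSum x y z (1 +ℕ n)
      ≈ e₁ x y z * powerSum x y z (2 +ℕ n) + e₃ x y z * powerSum x y z n
  powerSum-newton x y z n = solve 6
    (λ x y z a b c →
      x :* (x :* (x :* a)) :+ y :* (y :* (y :* b)) :+ z :* (z :* (z :* c))
        :+ (x :* y :+ x :* z :+ y :* z) :* (x :* a :+ y :* b :+ z :* c)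
      := (x :+ y :+ z) :* (x :* (x :* a) :+ y :* (y :* b) :+ z :* (z :* c))
        :+ (x :* y :* z) :* (a :+ b :+ c))
    refl x y z (x ^ n) (y ^ n) (z ^ n)

  powerSum-two : ∀ x y z → powerSum x y z 2 + e₂ x y z * (1# + 1#) ≈ e₁ x y z * e₁ x y z
  powerSum-two = solve 3
    (λ x y z →
      x :* (x :* con 1) :+ y :* (y :* con 1) :+ z :* (z :* con 1)
        :+ (x :* y :+ x :* z :+ y :* z) :* (con 1 :+ con 1)
      := (x :+ y :+ z) :* (x :+ y :+ z))
    refl

  e₂-square : ∀ x y z →
    (1# + 1#) * (e₃ x y z * e₁ x y z) + e₂ (x * x) (y * y) (z * z) ≈ e₂ x y z * e₂ x y z
  e₂-square = solve 3
    (λ x y z →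
      (con 1 :+ con 1) :* ((x :* y :* z) :* (x :+ y :+ z))
        :+ ((x :* x) :* (y :* y) :+ (x :* x) :* (z :* z) :+ (y :* y) :* (z :* z))
      := (x :* y :+ x :* z :+ y :* z) :* (x :* y :+ x :* z :+ y :* z))
    refl

  ^-distrib-e₃ : ∀ x y z n → e₃ x y z ^ n ≈ e₃ (x ^ n) (y ^ n) (z ^ n)
  ^-distrib-e₃ x y z n = begin
    (x * y * z) ^ n        ≈⟨ ^-distrib-* (x * y) z n ⟩
    (x * y) ^ n * z ^ n    ≈⟨ *-congʳ (^-distrib-* x y n) ⟩
    x ^ n * y ^ n * z ^ n  ∎

module CubicRoots {c ℓ} (R : CommutativeRing c ℓ) where
  open CommutativeRing R
  open Exponentiation semiring
  open Tribonacci semiring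
  open SymmetricFunctions commutativeSemiring
  open Exp semiring using (_^_; ^-congˡ)
  open Mult semiring using (_×_)
  open RingProperties ring using (-1*x≈-x)
  open GroupProperties +-group using (⁻¹-injective; ⁻¹-involutive; x≈z//y)
  open NaturalCoefficientsSolver commutativeSemiring using (solve; _:=_; _:+_; _:*_; con)
  open SetoidReasoning setoid

  pow≡^ : ∀ x n → pow R x n ≡ x ^ n
  pow≡^ x zero    = ≡.refl
  pow≡^ x (suc n) = ≡.cong (x *_) (pow≡^ x n)

  fromℕ≡× : ∀ n → fromℕ R n ≡ n × 1#
  fromℕ≡× zero    = ≡.refl
  fromℕ≡× (suc n) = ≡.cong (1# +_) (fromℕ≡× n)

  C≡e₂ : ∀ α β γ n → C R α β γ n ≡ e₂ (α ^ n) (β ^ n) (γ ^ n)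
  C≡e₂ α β γ n rewrite pow≡^ α n | pow≡^ β n | pow≡^ γ n = ≡.refl

  C-double : ∀ α β γ n → C R α β γ (2 *ℕ n) ≈ e₂ (α ^ n * α ^ n) (β ^ n * β ^ n) (γ ^ n * γ ^ n)
  C-double α β γ n rewrite C≡e₂ α β γ (2 *ℕ n) =
    +-cong (+-cong (*-cong (^-double α n) (^-double β n)) (*-cong (^-double α n) (^-double γ n)))
           (*-cong (^-double β n) (^-double γ n))

  -[-1*x]≈x : ∀ x → - (- 1# * x) ≈ x
  -[-1*x]≈x x = trans (-‿cong (-1*x≈-x x)) (⁻¹-involutive x)

  module _ {α β γ} (roots : AreRootsOfCubic R α β γ) where
    private
      p : ℕ → Carrier
      p = powerSum α β γ

    e₁≈1 : e₁ α β γ ≈ 1#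
    e₁≈1 = let (h₁ , _ , _) = roots in ⁻¹-injective h₁

    e₂≈-1 : e₂ α β γ ≈ - 1#
    e₂≈-1 = let (_ , h₂ , _) = roots in h₂

    e₃≈1 : e₃ α β γ ≈ 1#
    e₃≈1 = let (_ , _ , h₃) = roots in ⁻¹-injective h₃

    powerSum-isTribonacci : IsTribonacci p
    powerSum-isTribonacci n = begin
      p (3 +ℕ n)
        ≈⟨ x≈z//y _ _ _ (powerSum-newton α β γ n) ⟩
      e₁ α β γ * p (2 +ℕ n) + e₃ α β γ * p n - e₂ α β γ * p (1 +ℕ n)
        ≈⟨ +-cong (+-cong (*-congʳ e₁≈1) (*-congʳ e₃≈1)) (-‿cong (*-congʳ e₂≈-1)) ⟩
      1# * p (2 +ℕ n) + 1# * p n - - 1# * p (1 +ℕ n)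
        ≈⟨ +-congˡ (-[-1*x]≈x (p (1 +ℕ n))) ⟩
      1# * p (2 +ℕ n) + 1# * p n + p (1 +ℕ n)
        ≈⟨ rearrange (p (2 +ℕ n)) (p (1 +ℕ n)) (p n) ⟩
      p (2 +ℕ n) + p (1 +ℕ n) + p n
        ∎
      where
      rearrange : ∀ a b c → 1# * a + 1# * c + b ≈ a + b + c
      rearrange = solve 3 (λ a b c → con 1 :* a :+ con 1 :* c :+ b := a :+ b :+ c) refl

    powerSum≈S : ∀ n → p n ≈ fromℕ R (S n)
    powerSum≈S n = trans (tribonacci-unique powerSum-isTribonacci S-isTribonacci p₀≈3 p₁≈1 p₂≈3 n)
                         (reflexive (≡.sym (fromℕ≡× (S n))))
      where
      p₀≈3 : p 0 ≈ 3 × 1#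
      p₀≈3 = solve 0 (con 1 :+ con 1 :+ con 1 := con 1 :+ (con 1 :+ (con 1 :+ con 0))) refl

      p₁≈1 : p 1 ≈ 1 × 1#
      p₁≈1 = begin
        α * 1# + β * 1# + γ * 1#  ≈⟨ +-cong (+-cong (*-identityʳ α) (*-identityʳ β)) (*-identityʳ γ) ⟩
        e₁ α β γ                  ≈⟨ e₁≈1 ⟩
        1#                        ≈⟨ +-identityʳ 1# ⟨
        1# + 0#                   ∎

      p₂≈3 : p 2 ≈ 3 × 1#
      p₂≈3 = begin
        p 2                                         ≈⟨ x≈z//y _ _ _ (powerSum-two α β γ) ⟩
        e₁ α β γ * e₁ α β γ - e₂ α β γ * (1# + 1#)  ≈⟨ +-cong (*-cong e₁≈1 e₁≈1) (-‿cong (*-congʳ e₂≈-1)) ⟩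
        1# * 1# - - 1# * (1# + 1#)                  ≈⟨ +-congˡ (-[-1*x]≈x (1# + 1#)) ⟩
        1# * 1# + (1# + 1#)                         ≈⟨ one-plus-two ⟩
        3 × 1#                                      ∎
        where
        one-plus-two : 1# * 1# + (1# + 1#) ≈ 3 × 1#
        one-plus-two = solve 0 (con 1 :* con 1 :+ (con 1 :+ con 1) := con 1 :+ (con 1 :+ (con 1 :+ con 0))) refl

    e₃-powers≈1 : ∀ n → e₃ (α ^ n) (β ^ n) (γ ^ n) ≈ 1#
    e₃-powers≈1 n = begin
      e₃ (α ^ n) (β ^ n) (γ ^ n)  ≈⟨ ^-distrib-e₃ α β γ n ⟨
      e₃ α β γ ^ n                ≈⟨ ^-congˡ n e₃≈1 ⟩
      1# ^ n                      ≈⟨ ^-zeroˡ n ⟩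
      1#                          ∎

mainTheorem11 : ∀ {c ℓ} (R : CommutativeRing c ℓ) →
    let open CommutativeRing R in
    (α β γ : Carrier) → AreRootsOfCubic R α β γ →
    (n : ℕ) →
      (fromℕ R 2 * fromℕ R (S n))
        ≈ (C R α β γ n * C R α β γ n - C R α β γ (2 *ℕ n))
mainTheorem11 R α β γ roots n = begin
  fromℕ R 2 * fromℕ R (S n)                         ≈⟨ *-cong (+-congˡ (+-identityʳ 1#)) (sym (powerSum≈S roots n)) ⟩
  (1# + 1#) * e₁ a b c                              ≈⟨ *-congˡ (trans (*-congʳ (e₃-powers≈1 roots n)) (*-identityˡ _)) ⟨
  (1# + 1#) * (e₃ a b c * e₁ a b c)                 ≈⟨ x≈z//y _ _ _ (e₂-square a b c) ⟩
  e₂ a b c * e₂ a b c - e₂ (a * a) (b * b) (c * c)  ≈⟨ +-cong (reflexive (≡.cong₂ _*_ (C≡e₂ α β γ n) (C≡e₂ α β γ n)))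
                                                             (-‿cong (C-double α β γ n)) ⟨
  C R α β γ n * C R α β γ n - C R α β γ (2 *ℕ n)    ∎
  where
  open CommutativeRing R
  open SymmetricFunctions commutativeSemiring
  open CubicRoots R
  open Exp semiring using (_^_)
  open GroupProperties +-group using (x≈z//y)
  open SetoidReasoning setoid
  a b c : Carrier
  a = α ^ n
  b = β ^ n
  c = γ ^ n
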